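{- Every even weakly $\varphi^*$-practical number is practical.
   Context: $\varphi^*$ is the unitary totient function: the multiplicative function with $\varphi^*(p^k)=p^k-1$ for every prime $p$ and $k\ge1$. For multiplicative $f$, $S_f(n)=\sum_{d\mid n}f(d)$. Write $n=p_1^{e_1}\cdots p_k^{e_k}$ with distinct primes indexed so that $f(p_1)\le\cdots\le f(p_k)$, and put $m_i=\prod_{j=1}^i p_j^{e_j}$ for $0\le i<k$ (so $m_0=1$); $n$ is weakly $f$-practical if $f(p_{i+1})\le S_f(m_i)+1$ for every $0\le i<k$. A positive integer $n$ is practical if every positive integer $m\le\sigma(n)=\sum_{d\mid n}d$ is a sum of distinct divisors of $n$. -}

module Defs where

open import Data.Nat using (ℕ; zero; suc; _+_; _*_; _∸_; _^_; _≤_)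
open import Data.Nat.Divisibility using (_∣_; _∣?_)
open import Data.Nat.Primality using (Prime; prime?)
open import Data.Nat.ListAction using (sum; product)
open import Data.List using (List; []; _∷_; map; filter; upTo; foldl; length; lookup; take)
open import Data.List.Relation.Unary.All using (All)
open import Data.List.Relation.Unary.Unique.Propositional using (Unique)
open import Data.List.Relation.Unary.Linked using (Linked)
open import Data.Product using (_×_; _,_; proj₁; proj₂; ∃; ∃-syntax)
open import Data.Fin using (Fin; toℕ)
open import Data.Bool using (if_then_else_)
open import Relation.Nullary.Decidable using (does; _×-dec_)
open import Relation.Binary.PropositionalEquality using (_≡_)

-- divisors d of m with 0 ≤ d ≤ m (for m ≥ 1 these are exactly the positive divisors)
divisors : ℕ → List ℕ
divisors m = filter (_∣? m) (upTo (suc m))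

-- p-part of n : the largest power p^k (k ≤ n) dividing n, i.e. p^{v_p(n)} for prime p and n ≥ 1
ppart : ℕ → ℕ → ℕ
ppart p n = foldl (λ acc k → if does ((p ^ k) ∣? n) then p ^ k else acc) 1 (upTo (suc n))

-- unitary totient φ*(n) = ∏_{p prime, p ∣ n} (p^{v_p(n)} - 1);
-- the multiplicative function with φ*(p^k) = p^k - 1 (and φ*(1) = 1)
φ* : ℕ → ℕ
φ* n = product (map (λ p → ppart p n ∸ 1) (filter (λ p → prime? p ×-dec p ∣? n) (upTo (suc n))))

S : (ℕ → ℕ) → ℕ → ℕ
S f n = sum (map f (divisors n))

σ : ℕ → ℕ
σ n = S (λ d → d) n

-- prime-power factorisations as lists of (p , e)
PP : Set
PP = ℕ × ℕ

ppValue : PP → ℕ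
ppValue (p , e) = p ^ e

IsSortedFactorisation : (ℕ → ℕ) → ℕ → List PP → Set
IsSortedFactorisation f n F =
  All (λ pe → Prime (proj₁ pe) × 1 ≤ proj₂ pe) F
  × Unique (map proj₁ F)
  × Linked (λ a b → f (proj₁ a) ≤ f (proj₁ b)) F
  × product (map ppValue F) ≡ n

-- m_i = ∏_{j ≤ i} p_j^{e_j}
prefixProduct : ℕ → List PP → ℕ
prefixProduct i F = product (map ppValue (take i F))

-- weakly f-practical: for every 0 ≤ i < k, f(p_{i+1}) ≤ S_f(m_i) + 1
-- (the 0-based index i of the list points at p_{i+1})
WeaklyPractical : (ℕ → ℕ) → ℕ → Set
WeaklyPractical f n = ∃[ F ] (IsSortedFactorisation f n F
  × ((i : Fin (length F)) → f (proj₁ (lookup F i)) ≤ S f (prefixProduct (toℕ i) F) + 1))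

Practical : ℕ → Set
Practical n = (m : ℕ) → 1 ≤ m → m ≤ σ n →
  ∃[ ds ] (Unique ds × All (_∣ n) ds × sum ds ≡ m)

{-# OPTIONS --safe #-}
module Submission where

-- Stewart's criterion: if m is practical, p is a prime not dividing m and
-- p ≤ σ(m) + 1, then every m p^e is practical, since each N ≤ σ(m) + p σ(m p^(e-1))
-- splits as a + p Q with a ≤ σ(m) and Q ≤ σ(m p^(e-1)).  So n is practical as soon
-- as p_(i+1) ≤ σ(m_i) + 1 for every i.  For an even weakly φ*-practical n this holds:
-- p_1 = 2 because φ*(2) = 1 is the least value of φ* on primes, and for i ≥ 1 we have
-- m_i ≥ 2, where φ*(d) ≤ d on all divisors with φ*(m_i) < m_i, so
-- p_(i+1) - 1 = φ*(p_(i+1)) ≤ S_φ*(m_i) + 1 ≤ σ(m_i).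

open import Defs
open import Data.Nat using (ℕ; zero; suc; _+_; _*_; _∸_; _^_; _≤_; _<_; z≤n; s≤s; s≤s⁻¹; NonZero; >-nonZero; >-nonZero⁻¹)
open import Data.Nat.Properties
open import Data.Nat.Divisibility
open import Data.Nat.DivMod using (_/_; _%_; m≡m%n+[m/n]*n; m%n<n; m*n/n≡m; /-monoˡ-≤)
open import Data.Nat.Primality using (Prime; prime?; prime[2]; ¬prime[0]; ¬prime[1]; prime⇒nonZero; prime⇒irreducible; euclidsLemma)
open import Data.Nat.Primality.Factorisation using (factorise)
open import Data.Nat.Coprimality using (Coprime; coprime-divisor)
open import Data.Nat.ListAction using (sum; product)
open import Data.Nat.ListAction.Properties using (sum-++; product≢0)
open import Algebra.Properties.CommutativeSemigroup +-commutativeSemigroup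
  using () renaming (x∙yz≈y∙xz to +-left-comm)
open import Algebra.Properties.CommutativeSemigroup *-commutativeSemigroup
  using () renaming (x∙yz≈y∙xz to *-left-comm; x∙yz≈z∙xy to *-rotate)
open import Data.List using (List; []; _∷_; map; filter; upTo; applyUpTo; foldl; _++_; length; lookup)
open import Data.List.Properties using (map-id)
open import Data.List.Relation.Unary.All as All using (All; []; _∷_)
import Data.List.Relation.Unary.All.Properties as All
open import Data.List.Relation.Unary.Any using (Any; here; there)
import Data.List.Relation.Unary.Any.Properties as Any
open import Data.List.Relation.Unary.AllPairs using ([]; _∷_)
open import Data.List.Relation.Unary.Linked.Properties using (Linked⇒AllPairs)
open import Data.List.Relation.Unary.Unique.Propositional using (Unique)
import Data.List.Relation.Unary.Unique.Propositional.Properties as Unique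
open import Data.List.Relation.Binary.Subset.Propositional using (_⊆_)
open import Data.List.Membership.Propositional using (_∈_; find)
open import Data.List.Membership.Propositional.Properties
  using (∈-filter⁺; ∈-filter⁻; ∈-upTo⁺; ∈-applyUpTo⁻; ∈-map⁺; ∈-map⁻; ∈-++⁺ˡ; ∈-++⁺ʳ; ∈-++⁻; ∈-∃++)
open import Data.Bool using (if_then_else_)
open import Data.Fin using (Fin; toℕ; zero; suc)
open import Data.Product using (_×_; _,_; proj₁; proj₂; ∃-syntax)
open import Data.Sum using (inj₁; inj₂)
open import Data.Unit using (⊤; tt)
open import Data.Empty using (⊥-elim)
open import Relation.Nullary using (¬_; yes; no)
open import Relation.Nullary.Decidable using (does; _×-dec_)
open import Relation.Binary.PropositionalEquality
  using (_≡_; _≢_; refl; sym; trans; cong; cong₂; subst)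

sum-map-* : ∀ p (xs : List ℕ) → sum (map (p *_) xs) ≡ p * sum xs
sum-map-* p [] = sym (*-zeroʳ p)
sum-map-* p (x ∷ xs) = trans (cong (p * x +_) (sum-map-* p xs)) (sym (*-distribˡ-+ p x (sum xs)))

sum-mono-⊆ : ∀ {xs ys : List ℕ} → Unique xs → xs ⊆ ys → sum xs ≤ sum ys
sum-mono-⊆ {[]} _ _ = z≤n
sum-mono-⊆ {x ∷ xs} {ys} (x∉xs ∷ xs!) xs⊆ys with ys₁ , ys₂ , refl ← ∈-∃++ (xs⊆ys (here refl)) = begin
  x + sum xs                ≤⟨ +-monoʳ-≤ x (sum-mono-⊆ xs! xs⊆ys₁++ys₂) ⟩
  x + sum (ys₁ ++ ys₂)      ≡⟨ cong (x +_) (sum-++ ys₁ ys₂) ⟩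
  x + (sum ys₁ + sum ys₂)   ≡⟨ +-left-comm x (sum ys₁) (sum ys₂) ⟩
  sum ys₁ + (x + sum ys₂)   ≡⟨ sum-++ ys₁ (x ∷ ys₂) ⟨
  sum (ys₁ ++ x ∷ ys₂)      ∎
  where
  open ≤-Reasoning
  xs⊆ys₁++ys₂ : xs ⊆ ys₁ ++ ys₂
  xs⊆ys₁++ys₂ {v} v∈xs with ∈-++⁻ ys₁ (xs⊆ys (there v∈xs))
  ... | inj₁ v∈ys₁ = ∈-++⁺ˡ v∈ys₁
  ... | inj₂ (here v≡x) = ⊥-elim (All.lookup x∉xs v∈xs (sym v≡x))
  ... | inj₂ (there v∈ys₂) = ∈-++⁺ʳ ys₁ v∈ys₂

sum-map-mono-≤ : ∀ {f g : ℕ → ℕ} xs → All (λ x → f x ≤ g x) xs → sum (map f xs) ≤ sum (map g xs)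
sum-map-mono-≤ [] [] = z≤n
sum-map-mono-≤ (x ∷ xs) (fx≤gx ∷ f≤g) = +-mono-≤ fx≤gx (sum-map-mono-≤ xs f≤g)

sum-map-mono-< : ∀ {f g : ℕ → ℕ} {y} xs → All (λ x → f x ≤ g x) xs → y ∈ xs → f y < g y →
                 sum (map f xs) < sum (map g xs)
sum-map-mono-< (x ∷ xs) (_ ∷ f≤g) (here refl) fy<gy = +-mono-<-≤ fy<gy (sum-map-mono-≤ xs f≤g)
sum-map-mono-< (x ∷ xs) (fx≤gx ∷ f≤g) (there y∈xs) fy<gy = +-mono-≤-< fx≤gx (sum-map-mono-< xs f≤g y∈xs fy<gy)

product-map-∸1-≤ : ∀ (f : ℕ → ℕ) xs → product (map (λ x → f x ∸ 1) xs) ≤ product (map f xs)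
product-map-∸1-≤ f [] = ≤-refl
product-map-∸1-≤ f (x ∷ xs) = *-mono-≤ (m∸n≤m (f x) 1) (product-map-∸1-≤ f xs)

product-map-∸1-< : ∀ (f : ℕ → ℕ) {y} xs → y ∈ xs → All (λ x → NonZero (f x)) xs →
                   product (map (λ x → f x ∸ 1) xs) < product (map f xs)
product-map-∸1-< f (x ∷ xs) _ (fx≢0 ∷ f≢0) with f x | fx≢0
... | suc k | _ = begin-strict
  k * product (map (λ x → f x ∸ 1) xs) ≤⟨ *-monoʳ-≤ k (product-map-∸1-≤ f xs) ⟩
  k * product (map f xs)                <⟨ +-mono-<-≤ (>-nonZero⁻¹ _ {{product≢0 (All.map⁺ f≢0)}}) ≤-refl ⟩
  product (map f xs) + k * product (map f xs) ∎
  where open ≤-Reasoning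

product-≥-member : ∀ {x} (xs : List ℕ) → All NonZero xs → x ∈ xs → x ≤ product xs
product-≥-member (x ∷ xs) (_ ∷ xs≢0) (here refl) = m≤m*n x (product xs) {{product≢0 xs≢0}}
product-≥-member (y ∷ xs) (y≢0 ∷ xs≢0) (there x∈xs) =
  ≤-trans (product-≥-member xs xs≢0 x∈xs) (m≤n*m (product xs) y {{y≢0}})

prime⇒2≤ : ∀ {p} → Prime p → 2 ≤ p
prime⇒2≤ {0} pp = ⊥-elim (¬prime[0] pp)
prime⇒2≤ {1} pp = ⊥-elim (¬prime[1] pp)
prime⇒2≤ {suc (suc _)} _ = s≤s (s≤s z≤n)

prime∤1 : ∀ {p} → Prime p → ¬ p ∣ 1
prime∤1 pp p∣1 = ¬prime[1] (subst Prime (∣1⇒≡1 p∣1) pp)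

prime∣prime⇒≡ : ∀ {p q} → Prime p → Prime q → p ∣ q → p ≡ q
prime∣prime⇒≡ pp pq p∣q with prime⇒irreducible pq p∣q
... | inj₁ refl = ⊥-elim (¬prime[1] pp)
... | inj₂ p≡q = p≡q

prime∣m^n⇒∣m : ∀ {p m} n → Prime p → p ∣ m ^ n → p ∣ m
prime∣m^n⇒∣m zero pp p∣1 = ⊥-elim (prime∤1 pp p∣1)
prime∣m^n⇒∣m {m = m} (suc n) pp p∣m^[1+n] with euclidsLemma m (m ^ n) pp p∣m^[1+n]
... | inj₁ p∣m = p∣m
... | inj₂ p∣m^n = prime∣m^n⇒∣m n pp p∣m^n

prime∣product⇒any : ∀ {p} xs → Prime p → p ∣ product xs → Any (p ∣_) xs
prime∣product⇒any [] pp p∣1 = ⊥-elim (prime∤1 pp p∣1)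
prime∣product⇒any (x ∷ xs) pp p∣x*xs with euclidsLemma x (product xs) pp p∣x*xs
... | inj₁ p∣x = here p∣x
... | inj₂ p∣xs = there (prime∣product⇒any xs pp p∣xs)

prime∤⇒coprime : ∀ {p d} → Prime p → ¬ p ∣ d → Coprime d p
prime∤⇒coprime pp p∤d (i∣d , i∣p) with prime⇒irreducible pp i∣p
... | inj₁ i≡1 = i≡1
... | inj₂ refl = ⊥-elim (p∤d i∣d)

∣m*p^k∧prime∤⇒∣m : ∀ {p d} m k → Prime p → ¬ p ∣ d → d ∣ m * p ^ k → d ∣ m
∣m*p^k∧prime∤⇒∣m {d = d} m zero pp p∤d d∣m*1 = subst (d ∣_) (*-identityʳ m) d∣m*1
∣m*p^k∧prime∤⇒∣m {p} {d} m (suc k) pp p∤d d∣m*p^[1+k] =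
  ∣m*p^k∧prime∤⇒∣m m k pp p∤d
    (coprime-divisor (prime∤⇒coprime pp p∤d) (subst (d ∣_) (*-left-comm m p (p ^ k)) d∣m*p^[1+k]))

prime^k∣m*n∧∤m⇒∣n : ∀ {p m} k n → Prime p → ¬ p ∣ m → p ^ k ∣ m * n → p ^ k ∣ n
prime^k∣m*n∧∤m⇒∣n zero n pp p∤m _ = 1∣ n
prime^k∣m*n∧∤m⇒∣n {p} {m} (suc k) n pp p∤m p^[1+k]∣m*n
  with euclidsLemma m n pp (∣-trans (m∣m*n (p ^ k)) p^[1+k]∣m*n)
... | inj₁ p∣m = ⊥-elim (p∤m p∣m)
... | inj₂ (divides n′ refl) = subst (p * p ^ k ∣_) (*-comm p n′)
  (*-monoʳ-∣ p (prime^k∣m*n∧∤m⇒∣n k n′ pp p∤m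
    (*-cancelˡ-∣ p {{prime⇒nonZero pp}} (subst (p * p ^ k ∣_) (*-rotate m n′ p) p^[1+k]∣m*n))))

prime∤m*p^e : ∀ {p q m} e → Prime p → Prime q → p ≢ q → ¬ q ∣ m → ¬ q ∣ m * p ^ e
prime∤m*p^e {p} {q} {m} e pp pq p≢q q∤m q∣m*p^e with euclidsLemma m (p ^ e) pq q∣m*p^e
... | inj₁ q∣m = q∤m q∣m
... | inj₂ q∣p^e = p≢q (sym (prime∣prime⇒≡ pq pp (prime∣m^n⇒∣m e pq q∣p^e)))

-- The unitary totient

ppart-step : ℕ → ℕ → ℕ → ℕ → ℕ
ppart-step p n acc k = if does ((p ^ k) ∣? n) then p ^ k else acc

ppart-step-∣ : ∀ {p n acc k} → p ^ k ∣ n → ppart-step p n acc k ≡ p ^ k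
ppart-step-∣ {p} {n} {acc} {k} p^k∣n with (p ^ k) ∣? n
... | yes _ = refl
... | no p^k∤n = ⊥-elim (p^k∤n p^k∣n)

foldl-ppart-step-invariant : ∀ (P : ℕ → Set) {p n} xs {acc} → P acc →
  (∀ {k} → k ∈ xs → p ^ k ∣ n → P (p ^ k)) → P (foldl (ppart-step p n) acc xs)
foldl-ppart-step-invariant P [] Pacc _ = Pacc
foldl-ppart-step-invariant P {p} {n} (x ∷ xs) Pacc Ppow with (p ^ x) ∣? n
... | yes p^x∣n = foldl-ppart-step-invariant P xs (Ppow (here refl) p^x∣n) (λ k∈xs → Ppow (there k∈xs))
... | no _ = foldl-ppart-step-invariant P xs Pacc (λ k∈xs → Ppow (there k∈xs))

ppart≡p^k∣n : ∀ p n → ∃[ k ] (ppart p n ≡ p ^ k × p ^ k ∣ n)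
ppart≡p^k∣n p n = foldl-ppart-step-invariant (λ a → ∃[ k ] (a ≡ p ^ k × p ^ k ∣ n))
  (upTo (suc n)) (0 , refl , 1∣ n) (λ {k} _ p^k∣n → k , refl , p^k∣n)

-- The fold ranges over k = 0 … n: after the steps k = 0, 1 the accumulator is p,
-- and it only ever grows afterwards.
ppart-≥ : ∀ {p n} .{{_ : NonZero p}} → 1 ≤ n → p ∣ n → p ≤ ppart p n
ppart-≥ {p} {suc n} _ p∣n =
  foldl-ppart-step-invariant (p ≤_) (applyUpTo (λ i → suc (suc i)) n) p≤acc p≤p^k
  where
  p≤acc : p ≤ ppart-step p (suc n) (ppart-step p (suc n) 1 0) 1
  p≤acc = ≤-reflexive (sym (trans (ppart-step-∣ {p} {k = 1} (subst (_∣ suc n) (sym (*-identityʳ p)) p∣n))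
                                  (*-identityʳ p)))
  p≤p^k : ∀ {k} → k ∈ applyUpTo (λ i → suc (suc i)) n → p ^ k ∣ suc n → p ≤ p ^ k
  p≤p^k k∈ _ with i , _ , refl ← ∈-applyUpTo⁻ (λ i → suc (suc i)) k∈ =
    m≤m*n p (p ^ suc i) {{m^n≢0 p (suc i)}}

primeDivisors : ℕ → List ℕ
primeDivisors n = filter (λ p → prime? p ×-dec p ∣? n) (upTo (suc n))

∈-primeDivisors⁺ : ∀ {p n} → 1 ≤ n → Prime p → p ∣ n → p ∈ primeDivisors n
∈-primeDivisors⁺ {p} {suc n} _ pp p∣n =
  ∈-filter⁺ (λ p → prime? p ×-dec p ∣? suc n) (∈-upTo⁺ (s≤s (∣⇒≤ p∣n))) (pp , p∣n)

∈-primeDivisors⁻ : ∀ {p} n → p ∈ primeDivisors n → Prime p × p ∣ n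
∈-primeDivisors⁻ n p∈ = proj₂ (∈-filter⁻ (λ p → prime? p ×-dec p ∣? n) {xs = upTo (suc n)} p∈)

primeDivisors-unique : ∀ n → Unique (primeDivisors n)
primeDivisors-unique n = Unique.filter⁺ (λ p → prime? p ×-dec p ∣? n) (Unique.upTo⁺ (suc n))

2≤ppart : ∀ {p} n → p ∈ primeDivisors n → 2 ≤ ppart p n
2≤ppart zero ()
2≤ppart {p} n@(suc _) p∈ with pp , p∣n ← ∈-primeDivisors⁻ n p∈ =
  ≤-trans (prime⇒2≤ pp) (ppart-≥ {{prime⇒nonZero pp}} (s≤s z≤n) p∣n)

product-ppart∣ : ∀ n ps → Unique ps → All Prime ps → product (map (λ p → ppart p n) ps) ∣ n
product-ppart∣ n [] _ _ = 1∣ n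
product-ppart∣ n (p ∷ ps) (p∉ps ∷ ps!) (pp ∷ ps-prime)
  with k , ppart≡p^k , p^k∣n ← ppart≡p^k∣n p n
     | divides t n≡t*R ← product-ppart∣ n ps ps! ps-prime =
  subst (_∣ n) (cong (_* R) (sym ppart≡p^k))
    (subst (p ^ k * R ∣_) (sym n≡t*R) (*-monoˡ-∣ R p^k∣t))
  where
  R : ℕ
  R = product (map (λ p → ppart p n) ps)
  p∤R : ¬ p ∣ R
  p∤R p∣R with q , q∈ps , p∣ppart ← find (Any.map⁻ (prime∣product⇒any (map (λ p → ppart p n) ps) pp p∣R))
    with j , ppart≡q^j , _ ← ppart≡p^k∣n q n =
    All.lookup p∉ps q∈ps (prime∣prime⇒≡ pp (All.lookup ps-prime q∈ps)
      (prime∣m^n⇒∣m j pp (subst (p ∣_) ppart≡q^j p∣ppart)))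
  p^k∣t : p ^ k ∣ t
  p^k∣t = prime^k∣m*n∧∤m⇒∣n k t pp p∤R
    (subst (p ^ k ∣_) (trans n≡t*R (*-comm t R)) p^k∣n)

φ*<∏ppart : ∀ {n} → 2 ≤ n → φ* n < product (map (λ p → ppart p n) (primeDivisors n))
φ*<∏ppart {1} (s≤s ())
φ*<∏ppart {n@(suc (suc _))} _
  with record { factors = p ∷ ps ; isFactorisation = n≡p*ps ; factorsPrime = pp ∷ _ } ← factorise n =
  product-map-∸1-< (λ p → ppart p n) (primeDivisors n)
    (∈-primeDivisors⁺ (s≤s z≤n) pp (subst (p ∣_) (sym n≡p*ps) (m∣m*n (product ps))))
    (All.tabulate (λ p∈ → >-nonZero (≤-trans (s≤s z≤n) (2≤ppart n p∈))))

φ*< : ∀ {n} → 2 ≤ n → φ* n < n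
φ*< {n} 2≤n = <-≤-trans (φ*<∏ppart 2≤n)
  (∣⇒≤ {{>-nonZero (≤-trans (s≤s z≤n) 2≤n)}}
    (product-ppart∣ n (primeDivisors n) (primeDivisors-unique n)
      (All.tabulate (λ p∈ → proj₁ (∈-primeDivisors⁻ n p∈)))))

φ*≤ : ∀ {n} → 1 ≤ n → φ* n ≤ n
φ*≤ {1} _ = ≤-refl
φ*≤ {suc (suc n)} _ = <⇒≤ (φ*< (s≤s (s≤s z≤n)))

prime≤1+φ* : ∀ {p} → Prime p → p ≤ suc (φ* p)
prime≤1+φ* {p@(suc p-1)} pp = s≤s (begin
  p-1               ≡⟨⟩
  p ∸ 1             ≤⟨ ∸-monoˡ-≤ 1 (ppart-≥ {{prime⇒nonZero pp}} (s≤s z≤n) ∣-refl) ⟩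
  ppart p p ∸ 1     ≤⟨ product-≥-member factors factors≢0 (∈-map⁺ (λ q → ppart q p ∸ 1) p∈) ⟩
  φ* p              ∎)
  where
  open ≤-Reasoning
  factors : List ℕ
  factors = map (λ q → ppart q p ∸ 1) (primeDivisors p)
  p∈ : p ∈ primeDivisors p
  p∈ = ∈-primeDivisors⁺ (s≤s z≤n) pp ∣-refl
  factors≢0 : All NonZero factors
  factors≢0 = All.map⁺ (All.tabulate (λ q∈ → >-nonZero (∸-monoˡ-≤ 1 (2≤ppart p q∈))))

-- Sums of distinct divisors

∈-divisors⁺ : ∀ {n d} → 1 ≤ n → d ∣ n → d ∈ divisors n
∈-divisors⁺ {suc n} _ d∣n = ∈-filter⁺ (_∣? suc n) (∈-upTo⁺ (s≤s (∣⇒≤ d∣n))) d∣n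

∈-divisors⁻ : ∀ {n d} → d ∈ divisors n → d ∣ n
∈-divisors⁻ {n} d∈ = proj₂ (∈-filter⁻ (_∣? n) {xs = upTo (suc n)} d∈)

∈-divisors⇒1≤ : ∀ {n d} → 1 ≤ n → d ∈ divisors n → 1 ≤ d
∈-divisors⇒1≤ {n} {zero} 1≤n d∈ with refl ← 0∣⇒≡0 (∈-divisors⁻ {n} d∈) with () ← 1≤n
∈-divisors⇒1≤ {d = suc d} _ _ = s≤s z≤n

divisors-unique : ∀ n → Unique (divisors n)
divisors-unique n = Unique.filter⁺ (_∣? n) (Unique.upTo⁺ (suc n))

σ≡sum-divisors : ∀ n → σ n ≡ sum (divisors n)
σ≡sum-divisors n = cong sum (map-id (divisors n))

S[φ*]<σ : ∀ {m} → 2 ≤ m → S φ* m < σ m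
S[φ*]<σ {m} 2≤m = sum-map-mono-< (divisors m)
  (All.tabulate (λ d∈ → φ*≤ (∈-divisors⇒1≤ 1≤m d∈))) (∈-divisors⁺ 1≤m ∣-refl) (φ*< 2≤m)
  where
  1≤m : 1 ≤ m
  1≤m = ≤-trans (s≤s z≤n) 2≤m

SumOfDistinctDivisors : ℕ → ℕ → Set
SumOfDistinctDivisors m N = ∃[ ds ] (Unique ds × All (_∣ m) ds × sum ds ≡ N)

-- Covers m C forces C = σ m; keeping C free means that σ (p * M) ≤ σ m + p * σ M,
-- rather than the multiplicativity of σ, is all that has to be known about σ.
Covers : ℕ → ℕ → Set
Covers m C = (∀ N → N ≤ C → SumOfDistinctDivisors m N) × σ m ≤ C

covers-1 : Covers 1 1
covers-1 = sums , ≤-refl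
  where
  sums : ∀ N → N ≤ 1 → SumOfDistinctDivisors 1 N
  sums zero _ = [] , [] , [] , refl
  sums (suc zero) _ = 1 ∷ [] , [] ∷ [] , ∣-refl ∷ [] , refl
  sums (suc (suc _)) (s≤s ())

covers⇒practical : ∀ {n} → ∃[ C ] Covers n C → Practical n
covers⇒practical (_ , sums , σn≤C) N _ N≤σn = sums N (≤-trans N≤σn σn≤C)

sumOfDistinctDivisors-+-* : ∀ {p m M T a b} .{{_ : NonZero p}} → ¬ p ∣ m → m ∣ T → p * M ∣ T →
  SumOfDistinctDivisors m a → SumOfDistinctDivisors M b → SumOfDistinctDivisors T (a + p * b)
sumOfDistinctDivisors-+-* {p} p∤m m∣T pM∣T (ds , ds! , ds∣m , Σds≡a) (es , es! , es∣M , Σes≡b) =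
  ds ++ map (p *_) es
  , Unique.++⁺ ds! (Unique.map⁺ (*-cancelˡ-≡ _ _ p) es!) disjoint
  , All.++⁺ (All.map (λ d∣m → ∣-trans d∣m m∣T) ds∣m)
            (All.map⁺ (All.map (λ e∣M → ∣-trans (*-monoʳ-∣ p e∣M) pM∣T) es∣M))
  , trans (sum-++ ds (map (p *_) es)) (cong₂ _+_ Σds≡a (trans (sum-map-* p es) (cong (p *_) Σes≡b)))
  where
  disjoint : ∀ {v} → ¬ (v ∈ ds × v ∈ map (p *_) es)
  disjoint (v∈ds , v∈pes) with e , _ , refl ← ∈-map⁻ (p *_) v∈pes =
    p∤m (∣-trans (m∣m*n e) (All.lookup ds∣m v∈ds))

σ[p*M]≤σ[m]+p*σ[M] : ∀ {p m M} .{{_ : NonZero p}} → 1 ≤ m → 1 ≤ M →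
  (∀ {d} → ¬ p ∣ d → d ∣ p * M → d ∣ m) → σ (p * M) ≤ σ m + p * σ M
σ[p*M]≤σ[m]+p*σ[M] {p} {m} {M} 1≤m 1≤M coprime-part = begin
  σ (p * M)                                          ≡⟨ σ≡sum-divisors (p * M) ⟩
  sum (divisors (p * M))                             ≤⟨ sum-mono-⊆ (divisors-unique (p * M)) split ⟩
  sum (divisors m ++ map (p *_) (divisors M))        ≡⟨ sum-++ (divisors m) _ ⟩
  sum (divisors m) + sum (map (p *_) (divisors M))   ≡⟨ cong (sum (divisors m) +_) (sum-map-* p (divisors M)) ⟩
  sum (divisors m) + p * sum (divisors M)            ≡⟨ cong₂ (λ x y → x + p * y) (σ≡sum-divisors m) (σ≡sum-divisors M) ⟨
  σ m + p * σ M                                      ∎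
  where
  open ≤-Reasoning
  split : divisors (p * M) ⊆ divisors m ++ map (p *_) (divisors M)
  split {d} d∈ with p ∣? d
  ... | yes (divides q refl) = ∈-++⁺ʳ (divisors m) (subst (_∈ map (p *_) (divisors M)) (*-comm p q)
          (∈-map⁺ (p *_) (∈-divisors⁺ 1≤M (*-cancelˡ-∣ p (subst (_∣ p * M) (*-comm q p) (∈-divisors⁻ d∈))))))
  ... | no p∤d = ∈-++⁺ˡ (∈-divisors⁺ 1≤m (coprime-part p∤d (∈-divisors⁻ d∈)))

-- The hypothesis p ≤ C + 1 is what makes every residue N % p a sum of divisors of m.
covers-* : ∀ {p m M C X} .{{_ : NonZero p}} → ¬ p ∣ m → p ≤ suc C → 1 ≤ m → 1 ≤ M → m ∣ M →
  (∀ {d} → ¬ p ∣ d → d ∣ p * M → d ∣ m) → Covers m C → Covers M X → Covers (p * M) (C + p * X)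
covers-* {p} {m} {M} {C} {X} p∤m p≤1+C 1≤m 1≤M m∣M coprime-part (sums-m , σm≤C) (sums-M , σM≤X) =
  sums , ≤-trans (σ[p*M]≤σ[m]+p*σ[M] 1≤m 1≤M coprime-part) (+-mono-≤ σm≤C (*-monoʳ-≤ p σM≤X))
  where
  combine : ∀ {a b} → a ≤ C → b ≤ X → SumOfDistinctDivisors (p * M) (a + p * b)
  combine a≤C b≤X = sumOfDistinctDivisors-+-* p∤m (∣-trans m∣M (n∣m*n p)) ∣-refl
    (sums-m _ a≤C) (sums-M _ b≤X)
  sums : ∀ N → N ≤ C + p * X → SumOfDistinctDivisors (p * M) N
  sums N N≤ with N ≤? p * X
  ... | yes N≤pX = subst (SumOfDistinctDivisors (p * M)) (sym N≡) (combine N%p≤C N/p≤X)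
    where
    N%p≤C : N % p ≤ C
    N%p≤C = s≤s⁻¹ (≤-trans (m%n<n N p) p≤1+C)
    N/p≤X : N / p ≤ X
    N/p≤X = ≤-trans (/-monoˡ-≤ p (≤-trans N≤pX (≤-reflexive (*-comm p X)))) (≤-reflexive (m*n/n≡m X p))
    N≡ : N ≡ N % p + p * (N / p)
    N≡ = trans (m≡m%n+[m/n]*n N p) (cong (N % p +_) (*-comm (N / p) p))
  ... | no N≰pX = subst (SumOfDistinctDivisors (p * M)) (m∸n+n≡m (<⇒≤ (≰⇒> N≰pX))) (combine N∸pX≤C ≤-refl)
    where
    N∸pX≤C : N ∸ p * X ≤ C
    N∸pX≤C = ≤-trans (∸-monoˡ-≤ (p * X) N≤) (≤-reflexive (m+n∸n≡m C (p * X)))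

covers-*-^ : ∀ {p m C} → Prime p → ¬ p ∣ m → p ≤ suc C → 1 ≤ m → Covers m C →
  ∀ e → ∃[ X ] Covers (m * p ^ e) X
covers-*-^ {p} {m} {C} pp p∤m p≤1+C 1≤m covers zero =
  C , subst (λ x → Covers x C) (sym (*-identityʳ m)) covers
covers-*-^ {p} {m} {C} pp p∤m p≤1+C 1≤m covers (suc e)
  with X , covers-X ← covers-*-^ pp p∤m p≤1+C 1≤m covers e =
  C + p * X , subst (λ x → Covers x (C + p * X)) (*-left-comm p m (p ^ e))
    (covers-* {{prime⇒nonZero pp}} p∤m p≤1+C 1≤m (*-mono-≤ 1≤m (m^n>0 p {{prime⇒nonZero pp}} e))
      (m∣m*n (p ^ e)) coprime-part covers covers-X)
  where
  coprime-part : ∀ {d} → ¬ p ∣ d → d ∣ p * (m * p ^ e) → d ∣ m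
  coprime-part {d} p∤d d∣ = ∣m*p^k∧prime∤⇒∣m m (suc e) pp p∤d (subst (d ∣_) (*-left-comm p m (p ^ e)) d∣)

PrefixCondition : (ℕ → ℕ → Set) → ℕ → List PP → Set
PrefixCondition R m [] = ⊤
PrefixCondition R m ((p , e) ∷ F) = R p m × PrefixCondition R (m * p ^ e) F

lookup⇒prefixCondition : ∀ {R} F m →
  ((i : Fin (length F)) → R (proj₁ (lookup F i)) (m * prefixProduct (toℕ i) F)) → PrefixCondition R m F
lookup⇒prefixCondition [] m _ = tt
lookup⇒prefixCondition {R} ((p , e) ∷ F) m cond =
  subst (R p) (*-identityʳ m) (cond zero) ,
  lookup⇒prefixCondition F (m * p ^ e)
    (λ i → subst (R (proj₁ (lookup F i))) (sym (*-assoc m (p ^ e) _)) (cond (suc i)))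

prefixCondition-weaken : ∀ {R R′} F {m} → (∀ {p m} → Prime p → 2 ≤ m → R p m → R′ p m) → 2 ≤ m →
  All (λ pe → Prime (proj₁ pe)) F → PrefixCondition R m F → PrefixCondition R′ m F
prefixCondition-weaken [] _ _ _ _ = tt
prefixCondition-weaken ((p , e) ∷ F) {m} R⇒R′ 2≤m (pp ∷ F-prime) (Rpm , cond) =
  R⇒R′ pp 2≤m Rpm ,
  prefixCondition-weaken F R⇒R′ (≤-trans 2≤m (m≤m*n m (p ^ e) {{m^n≢0 p e {{prime⇒nonZero pp}}}})) F-prime cond

StewartCondition : ℕ → List PP → Set
StewartCondition = PrefixCondition (λ p m → p ≤ suc (σ m))

covers-*-product : ∀ F {m C} → 1 ≤ m → All (λ pe → Prime (proj₁ pe)) F → Unique (map proj₁ F) →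
  All (λ pe → ¬ proj₁ pe ∣ m) F → StewartCondition m F → Covers m C →
  ∃[ C′ ] Covers (m * product (map ppValue F)) C′
covers-*-product [] {m} {C} _ _ _ _ _ covers = C , subst (λ x → Covers x C) (sym (*-identityʳ m)) covers
covers-*-product ((p , e) ∷ F) {m} 1≤m (pp ∷ F-prime) (p∉F ∷ F!) (p∤m ∷ F∤m) (p≤1+σm , cond) covers
  with X , covers-X ← covers-*-^ pp p∤m (≤-trans p≤1+σm (s≤s (proj₂ covers))) 1≤m covers e
  with C′ , covers-C′ ← covers-*-product F (*-mono-≤ 1≤m (m^n>0 p {{prime⇒nonZero pp}} e)) F-prime F!
         (All.tabulate λ {qe} qe∈F → prime∤m*p^e e pp (All.lookup F-prime qe∈F)
           (All.lookup p∉F (∈-map⁺ proj₁ qe∈F)) (All.lookup F∤m qe∈F))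
         cond covers-X =
  C′ , subst (λ x → Covers x C′) (*-assoc m (p ^ e) _) covers-C′

WeakCondition : ℕ → List PP → Set
WeakCondition = PrefixCondition (λ p m → φ* p ≤ S φ* m + 1)

weak⇒stewart : ∀ {p m} → Prime p → 2 ≤ m → φ* p ≤ S φ* m + 1 → p ≤ suc (σ m)
weak⇒stewart {p} {m} pp 2≤m φ*p≤ = begin
  p                     ≤⟨ prime≤1+φ* pp ⟩
  suc (φ* p)            ≤⟨ s≤s φ*p≤ ⟩
  suc (S φ* m + 1)      ≡⟨ cong suc (+-comm (S φ* m) 1) ⟩
  suc (suc (S φ* m))    ≤⟨ s≤s (S[φ*]<σ 2≤m) ⟩
  suc (σ m)             ∎
  where open ≤-Reasoning

prime∣product⇒∈bases : ∀ {q} F → Prime q → All (λ pe → Prime (proj₁ pe)) F →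
  q ∣ product (map ppValue F) → q ∈ map proj₁ F
prime∣product⇒∈bases F pq F-prime q∣∏F
  with (p , e) , pe∈F , q∣p^e ← find (Any.map⁻ (prime∣product⇒any (map ppValue F) pq q∣∏F)) =
  subst (_∈ map proj₁ F) (sym (prime∣prime⇒≡ pq (All.lookup F-prime pe∈F) (prime∣m^n⇒∣m e pq q∣p^e)))
    (∈-map⁺ proj₁ pe∈F)

even⇒head≤2 : ∀ {n p e F} → 2 ∣ n → IsSortedFactorisation φ* n ((p , e) ∷ F) → p ≤ 2
even⇒head≤2 {p = p} {e} {F} 2∣n (F-prime , _ , sorted , ∏F≡n)
  with prime∣product⇒∈bases ((p , e) ∷ F) prime[2] (All.map proj₁ F-prime) (subst (2 ∣_) (sym ∏F≡n) 2∣n)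
... | here refl = ≤-refl
... | there 2∈F with (q , f) , qf∈F , refl ← ∈-map⁻ proj₁ 2∈F
  with φ*p≤φ*q ∷ _ ← Linked⇒AllPairs ≤-trans sorted =
  ≤-trans (prime≤1+φ* (proj₁ (All.lookup F-prime (here refl)))) (s≤s (All.lookup φ*p≤φ*q qf∈F))

weakCondition⇒stewartCondition : ∀ {n} F → 2 ∣ n → IsSortedFactorisation φ* n F →
  WeakCondition 1 F → StewartCondition 1 F
weakCondition⇒stewartCondition [] 2∣n (_ , _ , _ , ∏F≡n) _ =
  ⊥-elim (prime∤1 prime[2] (subst (2 ∣_) (sym ∏F≡n) 2∣n))
weakCondition⇒stewartCondition ((p , e@(suc e′)) ∷ F) 2∣n isF@((pp , _) ∷ F-prime , _) (_ , cond) =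
  even⇒head≤2 2∣n isF ,
  prefixCondition-weaken F weak⇒stewart 2≤p^e (All.map proj₁ F-prime) cond
  where
  2≤p^e : 2 ≤ 1 * p ^ e
  2≤p^e = ≤-trans (prime⇒2≤ pp) (subst (p ≤_) (sym (*-identityˡ (p ^ e)))
    (m≤m*n p (p ^ e′) {{m^n≢0 p e′ {{prime⇒nonZero pp}}}}))
weakCondition⇒stewartCondition ((p , zero) ∷ F) _ ((_ , ()) ∷ _ , _) _

lemma5p1 : (n : ℕ) → 1 ≤ n → 2 ∣ n → WeaklyPractical φ* n → Practical n
lemma5p1 n _ 2∣n (F , isF@(F-prime , F! , _ , ∏F≡n) , cond) =
  covers⇒practical (subst (λ m → ∃[ C ] Covers m C) (trans (*-identityˡ _) ∏F≡n) covered)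
  where
  weak : (i : Fin (length F)) → φ* (proj₁ (lookup F i)) ≤ S φ* (1 * prefixProduct (toℕ i) F) + 1
  weak i = subst (λ m → φ* (proj₁ (lookup F i)) ≤ S φ* m + 1)
    (sym (*-identityˡ (prefixProduct (toℕ i) F))) (cond i)
  stewart : StewartCondition 1 F
  stewart = weakCondition⇒stewartCondition F 2∣n isF (lookup⇒prefixCondition F 1 weak)
  covered : ∃[ C ] Covers (1 * product (map ppValue F)) C
  covered = covers-*-product F ≤-refl (All.map proj₁ F-prime) F!
    (All.tabulate (λ pe∈F → prime∤1 (proj₁ (All.lookup F-prime pe∈F)))) stewart covers-1
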